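{- Let $r,d,n\in\mathbb N$ with $d\ge2$ and $\delta>0$. Let $A$ be an $\ell\times k$ integer matrix of rank $\ell$. If every $r$-colouring of $[n]^d$ yields at least $\delta n^{d(k-\ell)}$ monochromatic solutions to $Ax=0$ in $[n]^d$, then every $r$-colouring of $[n]^{d-1}$ yields at least $\delta n^{(d-1)(k-\ell)}$ monochromatic solutions to $Ax=0$ in $[n]^{d-1}$.
   Context: $[n]=\{1,\dots,n\}$. A solution to $Ax=0$ in $[n]^m$ is a $k$-tuple $(x_1,\dots,x_k)$ with $x_j\in[n]^m$ and $\sum_j a_{ij}x_j=0\in\mathbb Z^m$ for each row $i$ (entries need not be distinct); it is monochromatic if all $x_j$ have the same colour.
   Formalization: The parameter δ ranges over the positive rationals. -}

module Defs where

open import Data.Nat using (ℕ; zero; suc; _^_; _*_; _∸_)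
open import Data.Integer as ℤ using (ℤ; +_; 0ℤ)
open import Data.Integer.Properties as ℤP using ()
open import Data.Fin using (Fin; zero; suc; toℕ)
open import Data.Fin.Properties as FinP using (all?)
open import Data.List using (List; []; _∷_; concatMap; map; filter; length; allFin)
open import Data.Product using (_×_; _,_)
open import Relation.Nullary using (Dec; ¬_)
open import Relation.Nullary.Decidable using (_×-dec_)
open import Relation.Binary.PropositionalEquality using (_≡_)
open import Data.Rational as ℚ using (ℚ; _/_)

Σℤ : (k : ℕ) → (Fin k → ℤ) → ℤ
Σℤ zero    f = 0ℤ
Σℤ (suc k) f = f zero ℤ.+ Σℤ k (λ j → f (suc j))

Matrix : ℕ → ℕ → Set
Matrix ℓ k = Fin ℓ → Fin k → ℤ

-- Rank ℓ for an ℓ × k matrix: the ℓ rows are linearly independent, i.e. the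
-- only integer combination of rows giving the zero vector is the trivial one.
-- (Independence over ℤ is the same as over ℚ by clearing denominators.)
HasRankℓ : ∀ {ℓ k} → Matrix ℓ k → Set
HasRankℓ {ℓ} {k} A =
  (c : Fin ℓ → ℤ) → (∀ j → Σℤ ℓ (λ i → c i ℤ.* A i j) ≡ 0ℤ) → ∀ i → c i ≡ 0ℤ

-- A point of [n]^m : coordinate value t : Fin n stands for the integer t+1 ∈ [n].
Point : ℕ → ℕ → Set
Point n m = Fin m → Fin n

val : ∀ {n} → Fin n → ℤ
val t = + suc (toℕ t)

Colouring : ℕ → ℕ → ℕ → Set
Colouring r n m = Point n m → Fin r

IsSolution : ∀ {ℓ k n m} → Matrix ℓ k → (Fin k → Point n m) → Set
IsSolution {ℓ} {k} A x = ∀ i c → Σℤ k (λ j → A i j ℤ.* val (x j c)) ≡ 0ℤ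

IsMono : ∀ {k r n m} → Colouring r n m → (Fin k → Point n m) → Set
IsMono χ x = ∀ i j → χ (x i) ≡ χ (x j)

isSolution? : ∀ {ℓ k n m} (A : Matrix ℓ k) x → Dec (IsSolution {n = n} {m = m} A x)
isSolution? {k = k} A x = all? λ i → all? λ c → Σℤ k (λ j → A i j ℤ.* val (x j c)) ℤ.≟ 0ℤ

isMono? : ∀ {k r n m} (χ : Colouring r n m) x → Dec (IsMono {k} χ x)
isMono? χ x = all? λ i → all? λ j → χ (x i) FinP.≟ χ (x j)

allFuns : ∀ {A : Set} (m : ℕ) → List A → List (Fin m → A)
allFuns zero    xs = (λ ()) ∷ []
allFuns (suc m) xs =
  concatMap (λ a → map (λ f → λ { zero → a ; (suc i) → f i }) (allFuns m xs)) xs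

allTuples : (k n m : ℕ) → List (Fin k → Point n m)
allTuples k n m = allFuns k (allFuns m (allFin n))

monoSolCount : ∀ {ℓ k r n m} → Matrix ℓ k → Colouring r n m → ℕ
monoSolCount {k = k} {n = n} {m = m} A χ =
  length (filter (λ x → isSolution? A x ×-dec isMono? χ x) (allTuples k n m))

ℕtoℚ : ℕ → ℚ
ℕtoℚ a = + a / 1

ManyMonoSols : ∀ {ℓ k} → Matrix ℓ k → (r n m : ℕ) → ℚ → Set
ManyMonoSols {ℓ} {k} A r n m δ =
  (χ : Colouring r n m) → δ ℚ.* ℕtoℚ (n ^ (m * (k ∸ ℓ))) ℚ.≤ ℕtoℚ (monoSolCount A χ)

-- Colour a point of [n]^d by the colour χ gives to its last d − 1 coordinates. A
-- monochromatic solution for this colouring is a monochromatic solution for χ in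
-- [n]^(d−1) together with a solution in [n] (the first coordinates), so the hypothesis
-- gives δ n^(d(k−ℓ)) ≤ M(χ) · S, where M(χ) counts the monochromatic solutions for χ
-- and S the solutions of Ax = 0 in [n].
-- Gaussian elimination bounds S by n^(k−ℓ): a zero first column contributes a free
-- factor n, while a pivot in the first column determines that variable from the others
-- and costs one equation, which leaves a matrix of rank ℓ − 1. Dividing by n^(k−ℓ)
-- gives δ n^((d−1)(k−ℓ)) ≤ M(χ).
module Submission where

open import Defs
open import Data.Nat as ℕ using (ℕ; zero; suc; _≥_; _∸_; s≤s; z≤n)
import Data.Nat.Properties as ℕP
import Data.Rational.Properties as ℚP
open import Data.Fin using (Fin; zero; suc; punchIn)
open import Data.List using (List; []; _∷_; _++_; map; concatMap; filter; length; tabulate; allFin)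
open import Data.Vec.Functional using (head; tail; insertAt) renaming (_∷_ to _◂_)
open import Data.Product using (_×_; _,_; uncurry)
open import Data.Rational using (ℚ; 0ℚ; _<_)
open import Function using (_∘_; id; _⇔_; mk⇔; Equivalence)
open import Relation.Nullary using (Dec; yes; no; ¬_; contradiction)
open import Relation.Nullary.Decidable using (_×-dec_)
open import Relation.Unary using (Pred; Decidable)
open import Relation.Binary.PropositionalEquality

module _ where
  open import Data.Nat using (_+_; _*_; _≤_)
  open import Data.Nat.Properties
    using (+-mono-≤; +-assoc; +-identityʳ; *-zeroʳ; *-distribˡ-+; *-distribʳ-+;
           ≤-refl; ≤-antisym; ≤-reflexive; +-commutativeSemigroup)
  open import Algebra.Properties.CommutativeSemigroup +-commutativeSemigroup using (interchange)
  open import Data.List.Relation.Unary.All using (All; []; _∷_)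
  open import Data.List.Relation.Unary.All.Properties using (tabulate⁺)
  open import Data.Fin.Properties using (suc-injective)

  ∑ : ∀ {A : Set} → List A → (A → ℕ) → ℕ
  ∑ []       f = 0
  ∑ (x ∷ xs) f = f x + ∑ xs f

  syntax ∑ xs (λ x → e) = ∑[ x ∈ xs ] e

  module _ {A : Set} where

    ∑-cong : ∀ (xs : List A) {f g : A → ℕ} → (∀ x → f x ≡ g x) → ∑ xs f ≡ ∑ xs g
    ∑-cong []       f≗g = refl
    ∑-cong (x ∷ xs) f≗g = cong₂ _+_ (f≗g x) (∑-cong xs f≗g)

    ∑-mono-≤ : ∀ (xs : List A) {f g : A → ℕ} → (∀ x → f x ≤ g x) → ∑ xs f ≤ ∑ xs g
    ∑-mono-≤ []       f≤g = z≤n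
    ∑-mono-≤ (x ∷ xs) f≤g = +-mono-≤ (f≤g x) (∑-mono-≤ xs f≤g)

    ∑-const : ∀ (xs : List A) c → ∑[ x ∈ xs ] c ≡ length xs * c
    ∑-const []       c = refl
    ∑-const (x ∷ xs) c = cong (c +_) (∑-const xs c)

    ∑-++ : ∀ (xs ys : List A) f → ∑ (xs ++ ys) f ≡ ∑ xs f + ∑ ys f
    ∑-++ []       ys f = refl
    ∑-++ (x ∷ xs) ys f = trans (cong (f x +_) (∑-++ xs ys f)) (sym (+-assoc (f x) _ _))

    ∑-distrib-+ : ∀ (xs : List A) f g → ∑[ x ∈ xs ] (f x + g x) ≡ ∑ xs f + ∑ xs g
    ∑-distrib-+ []       f g = refl
    ∑-distrib-+ (x ∷ xs) f g = trans (cong (f x + g x +_) (∑-distrib-+ xs f g))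
                                     (interchange (f x) (g x) (∑ xs f) (∑ xs g))

    *-distribˡ-∑ : ∀ (xs : List A) c f → c * ∑ xs f ≡ ∑[ x ∈ xs ] (c * f x)
    *-distribˡ-∑ []       c f = *-zeroʳ c
    *-distribˡ-∑ (x ∷ xs) c f = trans (*-distribˡ-+ c (f x) (∑ xs f)) (cong (c * f x +_) (*-distribˡ-∑ xs c f))

    *-distribʳ-∑ : ∀ (xs : List A) c f → ∑ xs f * c ≡ ∑[ x ∈ xs ] (f x * c)
    *-distribʳ-∑ []       c f = refl
    *-distribʳ-∑ (x ∷ xs) c f = trans (*-distribʳ-+ c (f x) (∑ xs f)) (cong (f x * c +_) (*-distribʳ-∑ xs c f))

  ∑-map : ∀ {A B : Set} (h : A → B) (xs : List A) f → ∑ (map h xs) f ≡ ∑[ x ∈ xs ] f (h x)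
  ∑-map h []       f = refl
  ∑-map h (x ∷ xs) f = cong (f (h x) +_) (∑-map h xs f)

  ∑-concatMap : ∀ {A B : Set} (h : A → List B) (xs : List A) f →
                ∑ (concatMap h xs) f ≡ ∑[ x ∈ xs ] ∑ (h x) f
  ∑-concatMap h []       f = refl
  ∑-concatMap h (x ∷ xs) f = trans (∑-++ (h x) (concatMap h xs) f) (cong (∑ (h x) f +_) (∑-concatMap h xs f))

  ∑-comm : ∀ {A B : Set} (xs : List A) (ys : List B) (f : A → B → ℕ) →
           ∑[ x ∈ xs ] ∑[ y ∈ ys ] f x y ≡ ∑[ y ∈ ys ] ∑[ x ∈ xs ] f x y
  ∑-comm []       ys f = sym (trans (∑-const ys 0) (*-zeroʳ (length ys)))
  ∑-comm (x ∷ xs) ys f = begin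
    ∑ ys (f x) + ∑[ x′ ∈ xs ] ∑ ys (f x′)         ≡⟨ cong (∑ ys (f x) +_) (∑-comm xs ys f) ⟩
    ∑ ys (f x) + ∑[ y ∈ ys ] ∑[ x′ ∈ xs ] f x′ y  ≡⟨ ∑-distrib-+ ys (f x) _ ⟨
    ∑[ y ∈ ys ] (f x y + ∑[ x′ ∈ xs ] f x′ y)     ∎
    where open ≡-Reasoning

  ∑-*-∑ : ∀ {A B : Set} (xs : List A) (ys : List B) (f : B → ℕ) (g : A → ℕ) →
          ∑[ x ∈ xs ] ∑[ y ∈ ys ] (f y * g x) ≡ ∑ ys f * ∑ xs g
  ∑-*-∑ xs ys f g = begin
    ∑[ x ∈ xs ] ∑[ y ∈ ys ] (f y * g x)  ≡⟨ ∑-cong xs (λ x → *-distribʳ-∑ ys (g x) f) ⟨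
    ∑[ x ∈ xs ] (∑ ys f * g x)           ≡⟨ *-distribˡ-∑ xs (∑ ys f) g ⟨
    ∑ ys f * ∑ xs g                      ∎
    where open ≡-Reasoning

  𝟙 : ∀ {p} {P : Set p} → Dec P → ℕ
  𝟙 (yes _) = 1
  𝟙 (no _)  = 0

  𝟙-mono : ∀ {p q} {P : Set p} {Q : Set q} (P? : Dec P) (Q? : Dec Q) → (P → Q) → 𝟙 P? ≤ 𝟙 Q?
  𝟙-mono (yes p) (yes q) P⇒Q = ≤-refl
  𝟙-mono (yes p) (no ¬q) P⇒Q = contradiction (P⇒Q p) ¬q
  𝟙-mono (no ¬p) Q?      P⇒Q = z≤n

  𝟙-cong : ∀ {p q} {P : Set p} {Q : Set q} (P? : Dec P) (Q? : Dec Q) → P ⇔ Q → 𝟙 P? ≡ 𝟙 Q?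
  𝟙-cong P? Q? P⇔Q = ≤-antisym (𝟙-mono P? Q? (Equivalence.to P⇔Q)) (𝟙-mono Q? P? (Equivalence.from P⇔Q))

  𝟙≤1 : ∀ {p} {P : Set p} (P? : Dec P) → 𝟙 P? ≤ 1
  𝟙≤1 (yes _) = ≤-refl
  𝟙≤1 (no _)  = z≤n

  𝟙-× : ∀ {p q} {P : Set p} {Q : Set q} (P? : Dec P) (Q? : Dec Q) → 𝟙 (P? ×-dec Q?) ≡ 𝟙 P? * 𝟙 Q?
  𝟙-× (yes p) (yes q) = refl
  𝟙-× (yes p) (no ¬q) = refl
  𝟙-× (no ¬p) Q?      = refl

  module _ {A : Set} {p} {P : Pred A p} (P? : Decidable P) where

    length-filter≡∑𝟙 : ∀ xs → length (filter P? xs) ≡ ∑[ x ∈ xs ] 𝟙 (P? x)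
    length-filter≡∑𝟙 []       = refl
    length-filter≡∑𝟙 (x ∷ xs) with P? x
    ... | yes _ = cong suc (length-filter≡∑𝟙 xs)
    ... | no _  = length-filter≡∑𝟙 xs

    ∑𝟙-none : ∀ {xs} → All (¬_ ∘ P) xs → ∑[ x ∈ xs ] 𝟙 (P? x) ≡ 0
    ∑𝟙-none {[]}     []           = refl
    ∑𝟙-none {x ∷ xs} (¬Px ∷ ¬Pxs) with P? x
    ... | yes Px = contradiction Px ¬Px
    ... | no _   = ∑𝟙-none ¬Pxs

    ∑𝟙-tabulate-unique : ∀ {n} (g : Fin n → A) → (∀ i j → P (g i) → P (g j) → i ≡ j) →
                         ∑[ x ∈ tabulate g ] 𝟙 (P? x) ≤ 1
    ∑𝟙-tabulate-unique {zero}  g unique = z≤n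
    ∑𝟙-tabulate-unique {suc n} g unique with P? (g zero)
    ... | yes P0 = ≤-reflexive (cong suc (∑𝟙-none (tabulate⁺ λ i Pi → 0≢suc (unique zero (suc i) P0 Pi))))
      where
      0≢suc : ∀ {i : Fin n} → zero ≢ suc i
      0≢suc ()
    ... | no _   = ∑𝟙-tabulate-unique (g ∘ suc) λ i j Pi Pj → suc-injective (unique (suc i) (suc j) Pi Pj)

  -- Functions can only be compared pointwise, so sums over tuples need summands
  -- that respect _≗_.
  Extensional : ∀ {A : Set} {k} → ((Fin k → A) → ℕ) → Set
  Extensional F = ∀ {x y} → x ≗ y → F x ≡ F y

  𝟙-extensional : ∀ {A : Set} {k} {P : (Fin k → A) → Set} (P? : ∀ x → Dec (P x)) →
                  (∀ {x y} → x ≗ y → P x → P y) → Extensional (λ x → 𝟙 (P? x))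
  𝟙-extensional P? P-resp x≗y = 𝟙-cong (P? _) (P? _) (mk⇔ (P-resp x≗y) (P-resp (sym ∘ x≗y)))

  ◂-extensional : ∀ {A : Set} {k} {F : (Fin (suc k) → A) → ℕ} → Extensional F →
                  ∀ a → Extensional (λ x → F (a ◂ x))
  ◂-extensional F-ext a x≗y = F-ext λ { zero → refl ; (suc i) → x≗y i }

  -- Summands of the form H (head f) (tail f) make this hold without any extensionality.
  ∑-allFuns-suc : ∀ {A : Set} m (xs : List A) (H : A → (Fin m → A) → ℕ) →
                  ∑[ f ∈ allFuns (suc m) xs ] H (head f) (tail f) ≡ ∑[ a ∈ xs ] ∑[ f ∈ allFuns m xs ] H a f
  ∑-allFuns-suc m xs H = trans (∑-concatMap _ xs _) (∑-cong xs λ a → ∑-map _ (allFuns m xs) _)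

  ∑-allFuns-suc-ext : ∀ {A : Set} m (xs : List A) {F : (Fin (suc m) → A) → ℕ} → Extensional F →
                      ∑ (allFuns (suc m) xs) F ≡ ∑[ a ∈ xs ] ∑[ f ∈ allFuns m xs ] F (a ◂ f)
  ∑-allFuns-suc-ext m xs {F} F-ext =
    trans (∑-cong (allFuns (suc m) xs) λ f → F-ext λ { zero → refl ; (suc i) → refl })
          (∑-allFuns-suc m xs λ a f → F (a ◂ f))

  ∑-allFuns-head-tail : ∀ {A : Set} k m (xs : List A) {P : (Fin k → Fin m → A) → ℕ} {Q : (Fin k → A) → ℕ} →
    Extensional P → Extensional Q →
    ∑[ x ∈ allFuns k (allFuns (suc m) xs) ] (P (tail ∘ x) * Q (head ∘ x))
      ≡ ∑ (allFuns k (allFuns m xs)) P * ∑ (allFuns k xs) Q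
  ∑-allFuns-head-tail zero m xs P-ext Q-ext =
    trans (+-identityʳ _) (cong₂ _*_ (trans (P-ext λ ()) (sym (+-identityʳ _)))
                                     (trans (Q-ext λ ()) (sym (+-identityʳ _))))
  ∑-allFuns-head-tail (suc k) m xs {P} {Q} P-ext Q-ext = begin
    ∑[ x ∈ allFuns (suc k) T ] (P (tail ∘ x) * Q (head ∘ x))
      ≡⟨ ∑-allFuns-suc-ext k T (λ x≗y → cong₂ _*_ (P-ext (cong tail ∘ x≗y)) (Q-ext (cong head ∘ x≗y))) ⟩
    ∑[ p ∈ T ] ∑[ x ∈ allFuns k T ] (P (tail ∘ (p ◂ x)) * Q (head ∘ (p ◂ x)))
      ≡⟨ ∑-cong T (λ p → ∑-cong (allFuns k T) λ x →
           cong₂ _*_ (P-ext λ { zero → refl ; (suc j) → refl }) (Q-ext λ { zero → refl ; (suc j) → refl })) ⟩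
    ∑[ p ∈ T ] ∑[ x ∈ allFuns k T ] (P (tail p ◂ tail ∘ x) * Q (head p ◂ head ∘ x))
      ≡⟨ ∑-allFuns-suc m xs (λ a q → ∑[ x ∈ allFuns k T ] (P (q ◂ tail ∘ x) * Q (a ◂ head ∘ x))) ⟩
    ∑[ a ∈ xs ] ∑[ q ∈ allFuns m xs ] ∑[ x ∈ allFuns k T ] (P (q ◂ tail ∘ x) * Q (a ◂ head ∘ x))
      ≡⟨ ∑-cong xs (λ a → ∑-cong (allFuns m xs) λ q →
           ∑-allFuns-head-tail k m xs (◂-extensional P-ext q) (◂-extensional Q-ext a)) ⟩
    ∑[ a ∈ xs ] ∑[ q ∈ allFuns m xs ] (∑[ y ∈ allFuns k U ] P (q ◂ y) * ∑[ z ∈ allFuns k xs ] Q (a ◂ z))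
      ≡⟨ ∑-*-∑ xs U _ _ ⟩
    (∑[ q ∈ U ] ∑[ y ∈ allFuns k U ] P (q ◂ y)) * (∑[ a ∈ xs ] ∑[ z ∈ allFuns k xs ] Q (a ◂ z))
      ≡⟨ cong₂ _*_ (∑-allFuns-suc-ext k U P-ext) (∑-allFuns-suc-ext k xs Q-ext) ⟨
    ∑ (allFuns (suc k) U) P * ∑ (allFuns (suc k) xs) Q
      ∎
    where
    open ≡-Reasoning
    T = allFuns (suc m) xs
    U = allFuns m xs

-- Integer sums and elimination of the first column

module _ where
  open import Data.Integer using (ℤ; 0ℤ; _+_; _*_; -_; _-_; _≟_; ≢-nonZero)
  open import Data.Integer.Properties as ℤP using (*-zeroʳ; *-assoc; *-cancelˡ-≡)
  open import Data.Integer.Tactic.RingSolver using (solve-∀)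
  open import Algebra.Properties.Semiring.Sum ℤP.+-*-semiring as ℤΣ using (sum)
  open import Algebra.Properties.AbelianGroup ℤP.+-0-abelianGroup using (∙-cancelʳ)
  open import Data.Fin.Properties using (all?; toℕ-injective)
  open import Data.Vec.Functional.Properties using (insertAt-lookup; insertAt-punchIn)

  Σℤ≡sum : ∀ k (f : Fin k → ℤ) → Σℤ k f ≡ sum f
  Σℤ≡sum zero    f = refl
  Σℤ≡sum (suc k) f = cong (f zero +_) (Σℤ≡sum k (f ∘ suc))

  Σℤ-cong : ∀ k {f g : Fin k → ℤ} → f ≗ g → Σℤ k f ≡ Σℤ k g
  Σℤ-cong zero    f≗g = refl
  Σℤ-cong (suc k) f≗g = cong₂ _+_ (f≗g zero) (Σℤ-cong k (f≗g ∘ suc))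

  Σℤ-zero : ∀ k {f : Fin k → ℤ} → (∀ j → f j ≡ 0ℤ) → Σℤ k f ≡ 0ℤ
  Σℤ-zero zero    f≡0 = refl
  Σℤ-zero (suc k) f≡0 = cong₂ _+_ (f≡0 zero) (Σℤ-zero k (f≡0 ∘ suc))

  Σℤ-linear : ∀ k a b (f g : Fin k → ℤ) →
              Σℤ k (λ j → a * f j + b * g j) ≡ a * Σℤ k f + b * Σℤ k g
  Σℤ-linear k a b f g = begin
    Σℤ k (λ j → a * f j + b * g j)             ≡⟨ Σℤ≡sum k _ ⟩
    sum (λ j → a * f j + b * g j)              ≡⟨ ℤΣ.∑-distrib-+ (λ j → a * f j) (λ j → b * g j) ⟩
    sum (λ j → a * f j) + sum (λ j → b * g j)  ≡⟨ cong₂ _+_ (ℤΣ.*-distribˡ-sum a f) (ℤΣ.*-distribˡ-sum b g) ⟨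
    a * sum f + b * sum g                      ≡⟨ cong₂ (λ s t → a * s + b * t) (Σℤ≡sum k f) (Σℤ≡sum k g) ⟨
    a * Σℤ k f + b * Σℤ k g                    ∎
    where open ≡-Reasoning

  Σℤ-punchIn : ∀ ℓ (p : Fin (suc ℓ)) (f : Fin (suc ℓ) → ℤ) → Σℤ (suc ℓ) f ≡ f p + Σℤ ℓ (f ∘ punchIn p)
  Σℤ-punchIn ℓ p f = begin
    Σℤ (suc ℓ) f              ≡⟨ Σℤ≡sum (suc ℓ) f ⟩
    sum f                     ≡⟨ ℤΣ.sum-remove f ⟩
    f p + sum (f ∘ punchIn p) ≡⟨ cong (f p +_) (Σℤ≡sum ℓ (f ∘ punchIn p)) ⟨
    f p + Σℤ ℓ (f ∘ punchIn p) ∎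
    where open ≡-Reasoning

  Σℤ-*ˡ : ∀ k a (f : Fin k → ℤ) → Σℤ k (λ j → a * f j) ≡ a * Σℤ k f
  Σℤ-*ˡ k a f = begin
    Σℤ k (λ j → a * f j)  ≡⟨ Σℤ≡sum k _ ⟩
    sum (λ j → a * f j)   ≡⟨ ℤΣ.*-distribˡ-sum a f ⟨
    a * sum f             ≡⟨ cong (a *_) (Σℤ≡sum k f) ⟨
    a * Σℤ k f            ∎
    where open ≡-Reasoning

  val-injective : ∀ {n} {a b : Fin n} → val a ≡ val b → a ≡ b
  val-injective = toℕ-injective ∘ ℕP.suc-injective ∘ ℤP.+-injective

  IsSolution₁ : ∀ {ℓ k n} → Matrix ℓ k → (Fin k → Fin n) → Set
  IsSolution₁ {k = k} A z = ∀ i → Σℤ k (λ j → A i j * val (z j)) ≡ 0ℤ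

  isSolution₁? : ∀ {ℓ k n} (A : Matrix ℓ k) (z : Fin k → Fin n) → Dec (IsSolution₁ A z)
  isSolution₁? {k = k} A z = all? λ i → Σℤ k (λ j → A i j * val (z j)) ≟ 0ℤ

  solution₁-extensional : ∀ {ℓ k n} {A : Matrix ℓ k} → Extensional {Fin n} (λ z → 𝟙 (isSolution₁? A z))
  solution₁-extensional {k = k} {A = A} = 𝟙-extensional (isSolution₁? A) λ z≗z′ sol i →
    trans (Σℤ-cong k λ j → cong (λ t → A i j * val t) (sym (z≗z′ j))) (sol i)

  dropFirstColumn : ∀ {ℓ k} → Matrix ℓ (suc k) → Matrix ℓ k
  dropFirstColumn A i = tail (A i)

  eliminate : ∀ {ℓ k} → Matrix (suc ℓ) (suc k) → Fin (suc ℓ) → Matrix ℓ k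
  eliminate A p i j = A p zero * A (punchIn p i) (suc j) - A (punchIn p i) zero * A p (suc j)

  module _ {ℓ k} (A : Matrix ℓ (suc k)) (column₀≡0 : ∀ i → A i zero ≡ 0ℤ) where

    dropFirstColumn-rank : HasRankℓ A → HasRankℓ (dropFirstColumn A)
    dropFirstColumn-rank rank c c·A′≡0 = rank c λ
      { zero    → Σℤ-zero ℓ λ i → trans (cong (c i *_) (column₀≡0 i)) (*-zeroʳ (c i))
      ; (suc j) → c·A′≡0 j }

    dropFirstColumn-solution : ∀ {n} {a : Fin n} {z} → IsSolution₁ A (a ◂ z) ⇔ IsSolution₁ (dropFirstColumn A) z
    dropFirstColumn-solution {a = a} = mk⇔ (λ sol i → trans (sym (first-term-vanishes i)) (sol i))
                                           (λ sol i → trans (first-term-vanishes i) (sol i))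
      where
      first-term-vanishes : ∀ i {s} → A i zero * val a + s ≡ s
      first-term-vanishes i rewrite column₀≡0 i = ℤP.+-identityˡ _

  module _ {ℓ k} (A : Matrix (suc ℓ) (suc k)) (p : Fin (suc ℓ)) where

    private
      α = A p zero
      β : Fin ℓ → ℤ
      β i = A (punchIn p i) zero

    eliminate-rank : α ≢ 0ℤ → HasRankℓ A → HasRankℓ (eliminate A p)
    eliminate-rank α≢0 rank c c·E≡0 i = *-cancelˡ-≡ α (c i) 0ℤ {{≢-nonZero α≢0}} (begin
        α * c i                ≡⟨ insertAt-punchIn (λ i → α * c i) p _ i ⟨
        c′ (punchIn p i)       ≡⟨ rank c′ c′·A≡0 (punchIn p i) ⟩
        0ℤ                     ≡⟨ *-zeroʳ α ⟨
        α * 0ℤ                 ∎)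
      where
      open ≡-Reasoning
      -- c′ rewrites the combination c of the eliminated rows as a combination of the rows of A.
      S = Σℤ ℓ (λ i → c i * β i)
      c′ : Fin (suc ℓ) → ℤ
      c′ = insertAt (λ i → α * c i) p (- S)
      regroup : ∀ S q a X → (- S) * q + a * X ≡ a * X + (- q) * S
      regroup = solve-∀
      distribute : ∀ c a P b q → a * (c * P) + (- q) * (c * b) ≡ c * (a * P - b * q)
      distribute = solve-∀
      c′·A≡c·E : ∀ j → Σℤ (suc ℓ) (λ r → c′ r * A r j)
                      ≡ Σℤ ℓ (λ i → c i * (α * A (punchIn p i) j - β i * A p j))
      c′·A≡c·E j = begin
        Σℤ (suc ℓ) (λ r → c′ r * A r j)
          ≡⟨ Σℤ-punchIn ℓ p (λ r → c′ r * A r j) ⟩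
        c′ p * A p j + Σℤ ℓ (λ i → c′ (punchIn p i) * A (punchIn p i) j)
          ≡⟨ cong₂ _+_ (cong (_* A p j) (insertAt-lookup _ p _))
                       (Σℤ-cong ℓ λ i → cong (_* A (punchIn p i) j) (insertAt-punchIn _ p _ i)) ⟩
        (- S) * A p j + Σℤ ℓ (λ i → α * c i * A (punchIn p i) j)
          ≡⟨ cong ((- S) * A p j +_) (trans (Σℤ-cong ℓ λ i → *-assoc α (c i) _) (Σℤ-*ˡ ℓ α _)) ⟩
        (- S) * A p j + α * Σℤ ℓ (λ i → c i * A (punchIn p i) j)
          ≡⟨ regroup S (A p j) α _ ⟩
        α * Σℤ ℓ (λ i → c i * A (punchIn p i) j) + (- A p j) * S
          ≡⟨ Σℤ-linear ℓ α (- A p j) _ _ ⟨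
        Σℤ ℓ (λ i → α * (c i * A (punchIn p i) j) + (- A p j) * (c i * β i))
          ≡⟨ Σℤ-cong ℓ (λ i → distribute (c i) α (A (punchIn p i) j) (β i) (A p j)) ⟩
        Σℤ ℓ (λ i → c i * (α * A (punchIn p i) j - β i * A p j))
          ∎
      c′·A≡0 : ∀ j → Σℤ (suc ℓ) (λ r → c′ r * A r j) ≡ 0ℤ
      c′·A≡0 zero    = trans (c′·A≡c·E zero) (Σℤ-zero ℓ λ i → commutator-vanishes (c i) α (β i))
        where
        commutator-vanishes : ∀ c a b → c * (a * b - b * a) ≡ 0ℤ
        commutator-vanishes = solve-∀
      c′·A≡0 (suc j) = trans (c′·A≡c·E (suc j)) (c·E≡0 j)

    eliminate-solution : ∀ {n} {a : Fin n} {z} → IsSolution₁ A (a ◂ z) → IsSolution₁ (eliminate A p) z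
    eliminate-solution {a = a} {z} sol i = begin
      Σℤ k (λ j → eliminate A p i j * val (z j))
        ≡⟨ Σℤ-cong k (λ j → distribute α (A (punchIn p i) (suc j)) (β i) (A p (suc j)) (val (z j))) ⟩
      Σℤ k (λ j → α * (A (punchIn p i) (suc j) * val (z j)) + (- β i) * (A p (suc j) * val (z j)))
        ≡⟨ Σℤ-linear k α (- β i) _ _ ⟩
      α * R (punchIn p i) + (- β i) * R p
        ≡⟨ cancel-pivot α (β i) (val a) (R (punchIn p i)) (R p) ⟩
      α * (β i * val a + R (punchIn p i)) + (- β i) * (α * val a + R p)
        ≡⟨ cong₂ (λ s t → α * s + (- β i) * t) (sol (punchIn p i)) (sol p) ⟩
      α * 0ℤ + (- β i) * 0ℤ
        ≡⟨ vanishes α (β i) ⟩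
      0ℤ
        ∎
      where
      open ≡-Reasoning
      R : Fin (suc ℓ) → ℤ
      R r = Σℤ k (λ j → A r (suc j) * val (z j))
      distribute : ∀ a P b q v → (a * P - b * q) * v ≡ a * (P * v) + (- b) * (q * v)
      distribute = solve-∀
      cancel-pivot : ∀ a b v X Y → a * X + (- b) * Y ≡ a * (b * v + X) + (- b) * (a * v + Y)
      cancel-pivot = solve-∀
      vanishes : ∀ a b → a * 0ℤ + (- b) * 0ℤ ≡ 0ℤ
      vanishes = solve-∀

    pivot-unique : α ≢ 0ℤ → ∀ {n} {a b : Fin n} {z} →
                   IsSolution₁ A (a ◂ z) → IsSolution₁ A (b ◂ z) → a ≡ b
    pivot-unique α≢0 {a = a} {b} sol-a sol-b = val-injective
      (*-cancelˡ-≡ α (val a) (val b) {{≢-nonZero α≢0}} (∙-cancelʳ _ _ _ (trans (sol-a p) (sym (sol-b p)))))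

-- Counting solutions in one coordinate

module _ where
  open import Data.Nat using (_*_; _^_; _≤_)
  open import Data.Nat.Properties
    using (≤-reflexive; ≤-trans; m≤n⇒m≤1+n; *-monoʳ-≤; +-∸-assoc; +-identityʳ; 0∸n≡0; module ≤-Reasoning)
  open import Data.Integer as ℤ using (0ℤ; +_)
  open import Data.Fin.Properties using (all?; ¬∀⟶∃¬)
  open import Data.List.Properties using (length-tabulate)
  open import Data.List.Relation.Unary.All.Properties using (tabulate⁺)

  solutionCount₁ : ∀ {ℓ k} → Matrix ℓ k → ℕ → ℕ
  solutionCount₁ {k = k} A n = ∑[ z ∈ allFuns k (allFin n) ] 𝟙 (isSolution₁? A z)

  data FirstColumn : ∀ {ℓ k} → Matrix ℓ (suc k) → Set where
    zeroColumn : ∀ {ℓ k} {A : Matrix ℓ (suc k)} → (∀ i → A i zero ≡ 0ℤ) → FirstColumn A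
    pivot      : ∀ {ℓ k} {A : Matrix (suc ℓ) (suc k)} (p : Fin (suc ℓ)) → A p zero ≢ 0ℤ → FirstColumn A

  firstColumn : ∀ {ℓ k} (A : Matrix ℓ (suc k)) → FirstColumn A
  firstColumn {zero}  A = zeroColumn λ ()
  firstColumn {suc ℓ} A with all? (λ i → A i zero ℤ.≟ 0ℤ)
  ... | yes column₀≡0 = zeroColumn column₀≡0
  ... | no column₀≢0  = uncurry pivot (¬∀⟶∃¬ _ _ (λ i → A i zero ℤ.≟ 0ℤ) column₀≢0)

  rank≤columns : ∀ {ℓ k} (A : Matrix ℓ k) → HasRankℓ A → ℓ ≤ k
  rank≤columns {zero}          A _    = z≤n
  rank≤columns {suc ℓ} {zero}  A rank = contradiction (rank (λ _ → + 1) (λ ()) zero) λ ()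
  rank≤columns {suc ℓ} {suc k} A rank with firstColumn A
  ... | zeroColumn column₀≡0 =
    m≤n⇒m≤1+n (rank≤columns (dropFirstColumn A) (dropFirstColumn-rank A column₀≡0 rank))
  ... | pivot p Ap₀≢0 = s≤s (rank≤columns (eliminate A p) (eliminate-rank A p Ap₀≢0 rank))

  solutionCount₁≤ : ∀ {ℓ k} (A : Matrix ℓ k) n → HasRankℓ A → solutionCount₁ A n ≤ n ^ (k ∸ ℓ)
  solutionCount₁≤ {ℓ} {zero} A n rank rewrite 0∸n≡0 ℓ = ≤-trans (≤-reflexive (+-identityʳ _)) (𝟙≤1 _)
  solutionCount₁≤ {ℓ} {suc k} A n rank with firstColumn A
  ... | zeroColumn column₀≡0 = begin
    solutionCount₁ A n
      ≡⟨ ∑-allFuns-suc-ext k (allFin n) (solution₁-extensional {A = A}) ⟩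
    ∑[ a ∈ allFin n ] ∑[ z ∈ allFuns k (allFin n) ] 𝟙 (isSolution₁? A (a ◂ z))
      ≡⟨ ∑-cong (allFin n) (λ a → ∑-cong (allFuns k (allFin n)) λ z →
           𝟙-cong _ _ (dropFirstColumn-solution A column₀≡0)) ⟩
    ∑[ a ∈ allFin n ] solutionCount₁ A′ n
      ≡⟨ ∑-const (allFin n) _ ⟩
    length (allFin n) * solutionCount₁ A′ n
      ≡⟨ cong (_* solutionCount₁ A′ n) (length-tabulate {n = n} id) ⟩
    n * solutionCount₁ A′ n
      ≤⟨ *-monoʳ-≤ n (solutionCount₁≤ A′ n rank′) ⟩
    n * n ^ (k ∸ ℓ)
      ≡⟨ cong (n ^_) (+-∸-assoc 1 (rank≤columns A′ rank′)) ⟨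
    n ^ (suc k ∸ ℓ)
      ∎
    where
    open ≤-Reasoning
    A′ = dropFirstColumn A
    rank′ = dropFirstColumn-rank A column₀≡0 rank
  ... | pivot {ℓ′} p Ap₀≢0 = begin
    solutionCount₁ A n
      ≡⟨ ∑-allFuns-suc-ext k (allFin n) (solution₁-extensional {A = A}) ⟩
    ∑[ a ∈ allFin n ] ∑[ z ∈ allFuns k (allFin n) ] 𝟙 (isSolution₁? A (a ◂ z))
      ≡⟨ ∑-comm (allFin n) (allFuns k (allFin n)) _ ⟩
    ∑[ z ∈ allFuns k (allFin n) ] ∑[ a ∈ allFin n ] 𝟙 (isSolution₁? A (a ◂ z))
      ≤⟨ ∑-mono-≤ (allFuns k (allFin n)) at-most-one-first-coordinate ⟩
    solutionCount₁ A′ n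
      ≤⟨ solutionCount₁≤ A′ n (eliminate-rank A p Ap₀≢0 rank) ⟩
    n ^ (k ∸ ℓ′)
      ∎
    where
    open ≤-Reasoning
    A′ = eliminate A p
    at-most-one-first-coordinate : ∀ z → ∑[ a ∈ allFin n ] 𝟙 (isSolution₁? A (a ◂ z)) ≤ 𝟙 (isSolution₁? A′ z)
    at-most-one-first-coordinate z with isSolution₁? A′ z
    ... | yes _    = ∑𝟙-tabulate-unique (λ a → isSolution₁? A (a ◂ z)) id λ a b → pivot-unique A p Ap₀≢0
    ... | no ¬sol′ = ≤-reflexive (∑𝟙-none (λ a → isSolution₁? A (a ◂ z)) {allFin n}
                                   (tabulate⁺ λ a sol → ¬sol′ (eliminate-solution A p sol)))

-- Monochromatic solutions of the colouring that ignores the first coordinate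

module _ where
  open import Data.Nat using (_*_; _≤_)
  open import Data.Nat.Properties using (module ≤-Reasoning)
  open import Data.Integer as ℤ using ()

  monoSolution? : ∀ {ℓ k r n m} (A : Matrix ℓ k) (χ : Colouring r n m) (x : Fin k → Point n m) →
                  Dec (IsSolution A x × IsMono χ x)
  monoSolution? A χ x = isSolution? A x ×-dec isMono? χ x

  monoSolution-extensional : ∀ {ℓ k r n m} {A : Matrix ℓ k} {χ : Colouring r n m} →
                             Extensional (λ x → 𝟙 (monoSolution? A χ x))
  monoSolution-extensional {k = k} {A = A} {χ} = 𝟙-extensional (monoSolution? A χ) λ x≗y (sol , mono) →
    (λ i c → trans (Σℤ-cong k λ j → cong (λ p → A i j ℤ.* val (p c)) (sym (x≗y j))) (sol i c)) ,
    (λ i j → trans (cong χ (sym (x≗y i))) (trans (mono i j) (cong χ (x≗y j))))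

  monoSolCount-tail≤ : ∀ {ℓ k r n m} (A : Matrix ℓ k) (χ : Colouring r n m) →
                       monoSolCount A (χ ∘ tail) ≤ monoSolCount A χ * solutionCount₁ A n
  monoSolCount-tail≤ {k = k} {n = n} {m} A χ = begin
    monoSolCount A (χ ∘ tail)
      ≡⟨ length-filter≡∑𝟙 (monoSolution? A (χ ∘ tail)) (allTuples k n (suc m)) ⟩
    ∑[ x ∈ allTuples k n (suc m) ] 𝟙 (monoSolution? A (χ ∘ tail) x)
      ≤⟨ ∑-mono-≤ (allTuples k n (suc m)) (λ x →
           𝟙-mono _ (monoSolution? A χ (tail ∘ x) ×-dec isSolution₁? A (head ∘ x)) split) ⟩
    ∑[ x ∈ allTuples k n (suc m) ] 𝟙 (monoSolution? A χ (tail ∘ x) ×-dec isSolution₁? A (head ∘ x))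
      ≡⟨ ∑-cong (allTuples k n (suc m)) (λ x → 𝟙-× (monoSolution? A χ (tail ∘ x)) (isSolution₁? A (head ∘ x))) ⟩
    ∑[ x ∈ allTuples k n (suc m) ] (𝟙 (monoSolution? A χ (tail ∘ x)) * 𝟙 (isSolution₁? A (head ∘ x)))
      ≡⟨ ∑-allFuns-head-tail k m (allFin n)
           (monoSolution-extensional {A = A} {χ}) (solution₁-extensional {A = A}) ⟩
    ∑ (allTuples k n m) (λ y → 𝟙 (monoSolution? A χ y)) * solutionCount₁ A n
      ≡⟨ cong (_* solutionCount₁ A n) (length-filter≡∑𝟙 (monoSolution? A χ) (allTuples k n m)) ⟨
    monoSolCount A χ * solutionCount₁ A n
      ∎
    where
    open ≤-Reasoning
    split : ∀ {x} → IsSolution A x × IsMono (χ ∘ tail) x →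
            (IsSolution A (tail ∘ x) × IsMono χ (tail ∘ x)) × IsSolution₁ A (head ∘ x)
    split (sol , mono) = ((λ i c → sol i (suc c)) , mono) , (λ i → sol i zero)

module _ where
  open import Data.Nat using (_^_)
  open import Data.Nat.Properties using (^-distribˡ-+-*)
  open import Data.Nat.Coprimality as Coprimality using (1-coprimeTo)
  open import Data.Integer as ℤ using (+_; +≤+)
  open import Data.Integer.Properties as ℤP using (pos-*)
  open import Data.Rational using (mkℚ; _/_; _*_; _≤_; *≤*; Positive)
  open import Data.Rational.Properties
    using (normalize-coprime; *-assoc; *-comm; *-zeroʳ; *-cancelʳ-≤-pos; module ≤-Reasoning)

  ℕtoℚ≡mkℚ : ∀ a → ℕtoℚ a ≡ mkℚ (+ a) 0 (Coprimality.sym (1-coprimeTo a))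
  ℕtoℚ≡mkℚ a = normalize-coprime (Coprimality.sym (1-coprimeTo a))

  ℕtoℚ-* : ∀ a b → ℕtoℚ a * ℕtoℚ b ≡ ℕtoℚ (a ℕ.* b)
  ℕtoℚ-* a b = trans (cong₂ _*_ (ℕtoℚ≡mkℚ a) (ℕtoℚ≡mkℚ b)) (cong (_/ 1) (sym (pos-* a b)))

  ℕtoℚ-mono-≤ : ∀ {a b} → a ℕ.≤ b → ℕtoℚ a ≤ ℕtoℚ b
  ℕtoℚ-mono-≤ {a} {b} a≤b = subst₂ _≤_ (sym (ℕtoℚ≡mkℚ a)) (sym (ℕtoℚ≡mkℚ b))
    (*≤* (subst₂ ℤ._≤_ (sym (ℤP.*-identityʳ (+ a))) (sym (ℤP.*-identityʳ (+ b))) (+≤+ a≤b)))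

  cancel-factor : ∀ δ a b c → δ * ℕtoℚ (a ℕ.* (a ℕ.* b)) ≤ ℕtoℚ (c ℕ.* a) → δ * ℕtoℚ (a ℕ.* b) ≤ ℕtoℚ c
  cancel-factor δ zero    b c _   = subst (_≤ ℕtoℚ c) (sym (*-zeroʳ δ)) (ℕtoℚ-mono-≤ {b = c} z≤n)
  cancel-factor δ (suc a) b c hyp = *-cancelʳ-≤-pos (ℕtoℚ (suc a)) {{positive}} (begin
    δ * ℕtoℚ (suc a ℕ.* b) * ℕtoℚ (suc a)    ≡⟨ *-assoc δ (ℕtoℚ (suc a ℕ.* b)) (ℕtoℚ (suc a)) ⟩
    δ * (ℕtoℚ (suc a ℕ.* b) * ℕtoℚ (suc a))  ≡⟨ cong (δ *_) (trans (*-comm (ℕtoℚ (suc a ℕ.* b)) (ℕtoℚ (suc a)))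
                                                                 (ℕtoℚ-* (suc a) (suc a ℕ.* b))) ⟩
    δ * ℕtoℚ (suc a ℕ.* (suc a ℕ.* b))       ≤⟨ hyp ⟩
    ℕtoℚ (c ℕ.* suc a)                        ≡⟨ ℕtoℚ-* c (suc a) ⟨
    ℕtoℚ c * ℕtoℚ (suc a)                     ∎)
    where
    open ≤-Reasoning
    positive : Positive (ℕtoℚ (suc a))
    positive = subst Positive (sym (ℕtoℚ≡mkℚ (suc a))) _

  cancel-power : ∀ δ n e m c → δ * ℕtoℚ (n ^ (suc (suc m) ℕ.* e)) ≤ ℕtoℚ (c ℕ.* n ^ e) →
                 δ * ℕtoℚ (n ^ (suc m ℕ.* e)) ≤ ℕtoℚ c
  cancel-power δ n e m c
    rewrite ^-distribˡ-+-* n e (suc m ℕ.* e) | ^-distribˡ-+-* n e (m ℕ.* e) = cancel-factor δ (n ^ e) _ c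

proposition10p4 : (r d n : ℕ) → d ≥ 2 → (δ : ℚ) → 0ℚ < δ →
    (ℓ k : ℕ) → (A : Matrix ℓ k) → HasRankℓ A →
    ManyMonoSols A r n d δ → ManyMonoSols A r n (d ∸ 1) δ
proposition10p4 r (suc (suc m)) n (s≤s (s≤s z≤n)) δ _ ℓ k A rank many χ =
  cancel-power δ n (k ∸ ℓ) m C (ℚP.≤-trans (many (χ ∘ tail)) (ℕtoℚ-mono-≤ lifted-count≤))
  where
  C = monoSolCount A χ
  lifted-count≤ : monoSolCount A (χ ∘ tail) ℕ.≤ C ℕ.* n ℕ.^ (k ∸ ℓ)
  lifted-count≤ = ℕP.≤-trans (monoSolCount-tail≤ A χ) (ℕP.*-monoʳ-≤ C (solutionCount₁≤ A n rank))
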